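{- Let $G$ be a maximal outerplane graph of order $n\geq 7$. Then $G\cong G_n$ if and only if $\Delta(G)=4$, where $G_n$ is the straight linear 2-tree on $n$ vertices.
   Context: All graphs are finite, simple, undirected and connected. A maximal outerplane graph is a maximal outerplanar graph (an outerplanar graph to which no edge can be added preserving outerplanarity) embedded in the plane with all vertices on the outer face. $\Delta(G)$ is the maximum degree. For $n\geq 3$, the straight linear 2-tree $G_n$ is the graph with vertex set $\{v_1,\dots,v_n\}$ in which $v_iv_j$ is an edge if and only if $0<|i-j|\leq 2$. -}

module Defs where

open import Data.Nat using (ℕ; _<_; _≤ᵇ_; _⊔_; ∣_-_∣; _+_)
open import Data.Bool using (Bool; true; false; _∧_; _∨_; if_then_else_)
open import Data.Fin using (Fin; toℕ; _≟_)
open import Data.List using (List; map; foldr; allFin)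
open import Data.Nat.ListAction using (sum)
open import Data.Fin.Permutation using (Permutation′; _⟨$⟩ʳ_)
open import Data.Product using (Σ; _×_)
open import Relation.Nullary using (¬_; ⌊_⌋)
open import Relation.Binary.PropositionalEquality using (_≡_; _≢_)
open import Data.Empty using (⊥)
open import Data.Nat.Properties using (∣-∣-comm; ∣n-n∣≡0)
open import Relation.Binary.PropositionalEquality using (cong)

Adj : ℕ → Set
Adj n = Fin n → Fin n → Bool

record SimpleGraph (n : ℕ) : Set where
  field
    adj     : Adj n
    symm    : ∀ u v → adj u v ≡ adj v u
    irrefl  : ∀ v → adj v v ≡ false
open SimpleGraph public

-- Outerplanarity (combinatorial form): the vertices can be placed on a circle,
-- in the cyclic order given by a permutation σ (vertex v gets position σ v),
-- so that no two edges cross as chords, i.e. there are no edges uv, xy with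
-- σu < σx < σv < σy.
NoCrossing : {n : ℕ} → Adj n → Permutation′ n → Set
NoCrossing {n} A σ = ∀ (u v x y : Fin n) → A u v ≡ true → A x y ≡ true →
  toℕ (σ ⟨$⟩ʳ u) < toℕ (σ ⟨$⟩ʳ x) →
  toℕ (σ ⟨$⟩ʳ x) < toℕ (σ ⟨$⟩ʳ v) →
  toℕ (σ ⟨$⟩ʳ v) < toℕ (σ ⟨$⟩ʳ y) → ⊥

Outerplanar : {n : ℕ} → Adj n → Set
Outerplanar {n} A = Σ (Permutation′ n) (NoCrossing A)

addEdge : {n : ℕ} → Adj n → Fin n → Fin n → Adj n
addEdge A a b x y = A x y ∨ (⌊ x ≟ a ⌋ ∧ ⌊ y ≟ b ⌋) ∨ (⌊ x ≟ b ⌋ ∧ ⌊ y ≟ a ⌋)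

MaximalOuterplanar : {n : ℕ} → SimpleGraph n → Set
MaximalOuterplanar {n} G =
  Outerplanar (adj G) ×
  (∀ (a b : Fin n) → a ≢ b → adj G a b ≡ false → ¬ Outerplanar (addEdge (adj G) a b))

degree : {n : ℕ} → SimpleGraph n → Fin n → ℕ
degree {n} G v = sum (map (λ u → if adj G v u then 1 else 0) (allFin n))

maxDegree : {n : ℕ} → SimpleGraph n → ℕ
maxDegree {n} G = foldr _⊔_ 0 (map (degree G) (allFin n))

_≅_ : {n : ℕ} → SimpleGraph n → SimpleGraph n → Set
_≅_ {n} G H = Σ (Permutation′ n) λ f → ∀ (u v : Fin n) → adj G u v ≡ adj H (f ⟨$⟩ʳ u) (f ⟨$⟩ʳ v)

-- Straight linear 2-tree G_n: vertices v_1..v_n (here 0..n-1), v_i v_j an edge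
-- iff 0 < |i - j| ≤ 2.
linAdj : (n : ℕ) → Adj n
linAdj n i j = (1 ≤ᵇ ∣ toℕ i - toℕ j ∣) ∧ (∣ toℕ i - toℕ j ∣ ≤ᵇ 2)


linearTwoTree : (n : ℕ) → SimpleGraph n
linearTwoTree n = record
  { adj    = linAdj n
  ; symm   = λ i j → cong (λ d → (1 ≤ᵇ d) ∧ (d ≤ᵇ 2)) (∣-∣-comm (toℕ i) (toℕ j))
  ; irrefl = λ i → cong (λ d → (1 ≤ᵇ d) ∧ (d ≤ᵇ 2)) (∣n-n∣≡0 (toℕ i))
  }

{-# OPTIONS --safe #-}
module Submission where

-- Put the vertices of G at positions 0, …, n - 1 in the order of its outer cycle, so that G is a
-- triangulation of a convex polygon.  Such a triangulation has an ear; after a rotation it sits at 0,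
-- and after a reflection, if needed, the triangle on the chord 1(n - 1) is 1 2 (n - 1).  From then on
-- Δ ≤ 4 forces every triangle: the apex of the triangle on a chord is pinned down because any other
-- apex would give an end of the chord five neighbours.  So the chords are the rungs K(n - K) and
-- (K + 1)(n - K), which is the straight linear 2-tree with v₀, v₁, v₂, v₃, … at 0, 1, n - 1, 2, ….
-- Conversely, in the straight linear 2-tree the vertex v₂ has degree 4 and no vertex has more.

open import Defs
open import Data.Bool using (Bool; true; false; _∧_; if_then_else_)
open import Data.Bool.Properties using (T?; T-≡; not-¬; ¬-not)
open import Data.Empty using (⊥; ⊥-elim)
open import Data.Fin as Fin using (Fin; toℕ; fromℕ<; #_)
open import Data.Fin.Permutation using (Permutation′; _⟨$⟩ʳ_; _⟨$⟩ˡ_; inverseʳ; inverseˡ; permutation)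
open import Data.Fin.Properties using (toℕ-injective; toℕ-fromℕ<; toℕ<n; fromℕ<-toℕ)
open import Data.List using (List; []; _∷_; _++_; map; filter; foldr; allFin; length)
open import Data.List.Properties using (length-map; length-++)
open import Data.List.Membership.Propositional using (_∈_)
open import Data.List.Membership.Propositional.Properties
  using (∈-∃++; ∈-filter⁺; ∈-filter⁻; ∈-allFin; ∈-map⁺; ∈-map⁻; ∈-++⁺ˡ; ∈-++⁺ʳ; ∈-++⁻)
open import Data.List.Relation.Binary.Subset.Propositional using (_⊆_)
open import Data.List.Relation.Unary.All as All using (All; []; _∷_)
import Data.List.Relation.Unary.All.Properties as All
open import Data.List.Properties using (foldr-preservesᵇ)
open import Data.List.Relation.Unary.AllPairs as AllPairs using ([]; _∷_)
open import Data.List.Relation.Unary.Linked using (Linked; [-]; _∷_)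
open import Data.List.Relation.Unary.Linked.Properties using (Linked⇒AllPairs)
open import Data.List.Relation.Unary.Any using (here; there)
open import Data.List.Relation.Unary.Unique.Propositional using (Unique)
import Data.List.Relation.Unary.Unique.Propositional.Properties as Unique
open import Data.Nat
open import Data.Nat.ListAction using (sum)
open import Data.Nat.Properties
open import Data.Product using (Σ; ∃; _×_; _,_; proj₁; proj₂)
open import Data.Sum using (_⊎_; inj₁; inj₂)
open import Function using (_∘_; _on_; Equivalence; Injection)
open import Function.Properties.Inverse using (↔⇒↣)
open import Relation.Binary.PropositionalEquality
open import Relation.Nullary using (¬_; yes; no)
open import Relation.Binary.Definitions using (tri<; tri≈; tri>)

unique⊆⇒length≤ : {A : Set} {xs ys : List A} → Unique xs → xs ⊆ ys → length xs ≤ length ys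
unique⊆⇒length≤ {xs = []} _ _ = z≤n
unique⊆⇒length≤ {xs = x ∷ xs} (x∉xs ∷ xs!) xs⊆ys with ∈-∃++ (xs⊆ys (here refl))
... | us , vs , refl = begin
  suc (length xs)              ≤⟨ s≤s (unique⊆⇒length≤ xs! xs⊆us++vs) ⟩
  suc (length (us ++ vs))      ≡⟨ cong suc (length-++ us) ⟩
  suc (length us + length vs)  ≡⟨ +-suc (length us) (length vs) ⟨
  length us + length (x ∷ vs)  ≡⟨ length-++ us ⟨
  length (us ++ x ∷ vs)        ∎
  where
  open ≤-Reasoning
  xs⊆us++vs : xs ⊆ us ++ vs
  xs⊆us++vs {y} y∈xs with ∈-++⁻ us (xs⊆ys (there y∈xs))
  ... | inj₁ y∈us = ∈-++⁺ˡ y∈us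
  ... | inj₂ (here refl) = ⊥-elim (All.lookup x∉xs y∈xs refl)
  ... | inj₂ (there y∈vs) = ∈-++⁺ʳ us y∈vs

unique-map⁺ : {A B : Set} {P : A → Set} {f : A → B} {xs : List A} →
  (∀ {x y} → P x → P y → f x ≡ f y → x ≡ y) → All P xs → Unique xs → Unique (map f xs)
unique-map⁺ f-injective [] [] = []
unique-map⁺ f-injective (px ∷ pxs) (x∉xs ∷ xs!) =
  All.map⁺ (All.zipWith (λ (py , x≢y) → x≢y ∘ f-injective px py) (pxs , x∉xs))
  ∷ unique-map⁺ f-injective pxs xs!

∈⇒≤foldr-⊔ : ∀ {x xs} → x ∈ xs → x ≤ foldr _⊔_ 0 xs
∈⇒≤foldr-⊔ (here refl) = m≤m⊔n _ _
∈⇒≤foldr-⊔ {xs = y ∷ _} (there x∈xs) = ≤-trans (∈⇒≤foldr-⊔ x∈xs) (m≤n⊔m y _)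

ascending⇒unique : ∀ {xs} → Linked _<_ xs → Unique xs
ascending⇒unique = AllPairs.map <⇒≢ ∘ Linked⇒AllPairs <-trans

module _ {n : ℕ} (G : SimpleGraph n) where

  neighbours : Fin n → List (Fin n)
  neighbours v = filter (T? ∘ adj G v) (allFin n)

  degree≡length-neighbours : ∀ v → degree G v ≡ length (neighbours v)
  degree≡length-neighbours v = go (allFin n)
    where
    go : ∀ us → sum (map (λ u → if adj G v u then 1 else 0) us) ≡ length (filter (T? ∘ adj G v) us)
    go [] = refl
    go (u ∷ us) with adj G v u
    ... | true = cong suc (go us)
    ... | false = go us

  length≤degree : ∀ {A : Set} {v} (key : Fin n → A) {ks} → Unique ks →
    (∀ {k} → k ∈ ks → ∃ λ u → adj G v u ≡ true × key u ≡ k) → length ks ≤ degree G v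
  length≤degree {v = v} key {ks} ks! keyed = begin
    length ks                        ≤⟨ unique⊆⇒length≤ ks! ks⊆keys ⟩
    length (map key (neighbours v))  ≡⟨ length-map key (neighbours v) ⟩
    length (neighbours v)            ≡⟨ degree≡length-neighbours v ⟨
    degree G v                       ∎
    where
    open ≤-Reasoning
    ks⊆keys : ks ⊆ map key (neighbours v)
    ks⊆keys k∈ks with keyed k∈ks
    ... | u , adjacent , refl =
      ∈-map⁺ key (∈-filter⁺ (T? ∘ adj G v) (∈-allFin u) (Equivalence.from T-≡ adjacent))

  degree≤length : ∀ {A : Set} {v} (key : Fin n → A) → (∀ {u w} → key u ≡ key w → u ≡ w) →
    ∀ {ks} → (∀ {u} → adj G v u ≡ true → key u ∈ ks) → degree G v ≤ length ks
  degree≤length {v = v} key key-injective {ks} keys = begin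
    degree G v                       ≡⟨ degree≡length-neighbours v ⟩
    length (neighbours v)            ≡⟨ length-map key (neighbours v) ⟨
    length (map key (neighbours v))  ≤⟨ unique⊆⇒length≤ keys! keys⊆ks ⟩
    length ks                        ∎
    where
    open ≤-Reasoning
    keys! : Unique (map key (neighbours v))
    keys! = Unique.map⁺ key-injective (Unique.filter⁺ (T? ∘ adj G v) (Unique.allFin⁺ n))
    keys⊆ks : map key (neighbours v) ⊆ ks
    keys⊆ks k∈ with ∈-map⁻ key k∈
    ... | u , u∈ , refl = keys (Equivalence.to T-≡ (proj₂ (∈-filter⁻ (T? ∘ adj G v) {xs = allFin n} u∈)))

  degree≤maxDegree : ∀ v → degree G v ≤ maxDegree G
  degree≤maxDegree v = ∈⇒≤foldr-⊔ (∈-map⁺ (degree G) (∈-allFin v))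

  maxDegree≤ : ∀ {k} → (∀ v → degree G v ≤ k) → maxDegree G ≤ k
  maxDegree≤ {k} bound = foldr-preservesᵇ {P = _≤ k} ⊔-lub z≤n (All.map⁺ (All.tabulate⁺ bound))

linAdjℕ : ℕ → ℕ → Bool
linAdjℕ i j = (1 ≤ᵇ ∣ i - j ∣) ∧ (∣ i - j ∣ ≤ᵇ 2)

linAdjℕ-comm : ∀ i j → linAdjℕ i j ≡ linAdjℕ j i
linAdjℕ-comm i j = cong (λ d → (1 ≤ᵇ d) ∧ (d ≤ᵇ 2)) (∣-∣-comm i j)

∣i-j∣≡d⇒ : ∀ i j {d} → ∣ i - j ∣ ≡ d → j ≡ i + d ⊎ i ≡ j + d
∣i-j∣≡d⇒ zero j eq = inj₁ eq
∣i-j∣≡d⇒ (suc i) zero eq = inj₂ eq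
∣i-j∣≡d⇒ (suc i) (suc j) eq with ∣i-j∣≡d⇒ i j eq
... | inj₁ j≡i+d = inj₁ (cong suc j≡i+d)
... | inj₂ i≡j+d = inj₂ (cong suc i≡j+d)

linAdjℕ⇒∈ : ∀ i j → linAdjℕ i j ≡ true → j ∈ i ∸ 2 ∷ i ∸ 1 ∷ i + 1 ∷ i + 2 ∷ []
linAdjℕ⇒∈ i j adjacent with ∣ i - j ∣ in eq
... | 1 with ∣i-j∣≡d⇒ i j eq
...   | inj₁ j≡i+1 = there (there (here j≡i+1))
...   | inj₂ refl = there (here (sym (m+n∸n≡m j 1)))
linAdjℕ⇒∈ i j adjacent | 2 with ∣i-j∣≡d⇒ i j eq
...   | inj₁ j≡i+2 = there (there (there (here j≡i+2)))
...   | inj₂ refl = here (sym (m+n∸n≡m j 2))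

≅linearTwoTree⇒maxDegree≡4 : ∀ {n} (G : SimpleGraph n) → 5 ≤ n → G ≅ linearTwoTree n → maxDegree G ≡ 4
≅linearTwoTree⇒maxDegree≡4 {n} G (s≤s (s≤s (s≤s (s≤s (s≤s _))))) (π , π-iso) =
  ≤-antisym (maxDegree≤ G degree≤4) (≤-trans 4≤degree (degree≤maxDegree G v₂))
  where
  degree≤4 : ∀ v → degree G v ≤ 4
  degree≤4 v = degree≤length G (toℕ ∘ (π ⟨$⟩ʳ_)) (Injection.injective (↔⇒↣ π) ∘ toℕ-injective)
    λ {u} vu → linAdjℕ⇒∈ (toℕ (π ⟨$⟩ʳ v)) _ (trans (sym (π-iso v u)) vu)

  v₂ : Fin n
  v₂ = π ⟨$⟩ˡ # 2

  near₂ : All (λ k → linAdj n (# 2) k ≡ true) (# 0 ∷ # 1 ∷ # 3 ∷ # 4 ∷ [])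
  near₂ = refl ∷ refl ∷ refl ∷ refl ∷ []

  4≤degree : 4 ≤ degree G v₂
  4≤degree = length≤degree G (π ⟨$⟩ʳ_)
    (((λ ()) ∷ (λ ()) ∷ (λ ()) ∷ []) ∷ ((λ ()) ∷ (λ ()) ∷ []) ∷ ((λ ()) ∷ []) ∷ [] ∷ [])
    λ k∈ → π ⟨$⟩ˡ _
         , trans (π-iso _ _) (trans (cong₂ (linAdj n) (inverseʳ π) (inverseʳ π)) (All.lookup near₂ k∈))
         , inverseʳ π

private variable
  a b c d : ℕ

Ascending : ℕ → ℕ → ℕ → ℕ → Set
Ascending a b c d = a < b × b < c × c < d

CyclicallyAscending : ℕ → ℕ → ℕ → ℕ → Set
CyclicallyAscending a b c d = Ascending a b c d ⊎ Ascending b c d a ⊎ Ascending c d a b ⊎ Ascending d a b c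

-- The chords ac and bd of a convex polygon cross.
Crossing : ℕ → ℕ → ℕ → ℕ → Set
Crossing a b c d = CyclicallyAscending a b c d ⊎ CyclicallyAscending d c b a

cyclicallyAscending-rotate : CyclicallyAscending a b c d → CyclicallyAscending b c d a
cyclicallyAscending-rotate (inj₁ x) = inj₂ (inj₂ (inj₂ x))
cyclicallyAscending-rotate (inj₂ (inj₁ x)) = inj₁ x
cyclicallyAscending-rotate (inj₂ (inj₂ (inj₁ x))) = inj₂ (inj₁ x)
cyclicallyAscending-rotate (inj₂ (inj₂ (inj₂ x))) = inj₂ (inj₂ (inj₁ x))

cyclicallyAscending-rotate⁻¹ : CyclicallyAscending b c d a → CyclicallyAscending a b c d
cyclicallyAscending-rotate⁻¹ (inj₁ x) = inj₂ (inj₁ x)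
cyclicallyAscending-rotate⁻¹ (inj₂ (inj₁ x)) = inj₂ (inj₂ (inj₁ x))
cyclicallyAscending-rotate⁻¹ (inj₂ (inj₂ (inj₁ x))) = inj₂ (inj₂ (inj₂ x))
cyclicallyAscending-rotate⁻¹ (inj₂ (inj₂ (inj₂ x))) = inj₁ x

crossing-rotate : Crossing a b c d → Crossing b c d a
crossing-rotate (inj₁ x) = inj₁ (cyclicallyAscending-rotate x)
crossing-rotate (inj₂ x) = inj₂ (cyclicallyAscending-rotate⁻¹ x)

crossing-reverse : Crossing a b c d → Crossing d c b a
crossing-reverse (inj₁ x) = inj₂ x
crossing-reverse (inj₂ x) = inj₁ x

crossing-swapʳ : Crossing a b c d → Crossing a d c b
crossing-swapʳ = crossing-rotate ∘ crossing-rotate ∘ crossing-rotate ∘ crossing-reverse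

crossing-split : Crossing a b c d → b < d →
  Ascending a b c d ⊎ Ascending b a d c ⊎ Ascending c b a d ⊎ Ascending b c d a
crossing-split (inj₁ (inj₁ x)) _ = inj₁ x
crossing-split (inj₁ (inj₂ (inj₁ x))) _ = inj₂ (inj₂ (inj₂ x))
crossing-split (inj₁ (inj₂ (inj₂ (inj₁ (_ , d<a , a<b))))) b<d = ⊥-elim (<-asym b<d (<-trans d<a a<b))
crossing-split (inj₁ (inj₂ (inj₂ (inj₂ (d<a , a<b , _))))) b<d = ⊥-elim (<-asym b<d (<-trans d<a a<b))
crossing-split (inj₂ (inj₁ (d<c , c<b , _))) b<d = ⊥-elim (<-asym b<d (<-trans d<c c<b))
crossing-split (inj₂ (inj₂ (inj₁ x))) _ = inj₂ (inj₂ (inj₁ x))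
crossing-split (inj₂ (inj₂ (inj₂ (inj₁ x)))) _ = inj₂ (inj₁ x)
crossing-split (inj₂ (inj₂ (inj₂ (inj₂ (_ , d<c , c<b))))) b<d = ⊥-elim (<-asym b<d (<-trans d<c c<b))

PreservesCrossing : ℕ → (ℕ → ℕ) → Set
PreservesCrossing n f = ∀ {a b c d} → a < n → b < n → c < n → d < n →
  Crossing a b c d → Crossing (f a) (f b) (f c) (f d)

ascending⇒preservesCrossing : ∀ {n} f →
  (∀ {a b c d} → d < n → Ascending a b c d → Crossing (f a) (f b) (f c) (f d)) → PreservesCrossing n f
ascending⇒preservesCrossing f h a<n b<n c<n d<n (inj₁ (inj₁ x)) = h d<n x
ascending⇒preservesCrossing f h a<n b<n c<n d<n (inj₁ (inj₂ (inj₁ x))) =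
  crossing-rotate (crossing-rotate (crossing-rotate (h a<n x)))
ascending⇒preservesCrossing f h a<n b<n c<n d<n (inj₁ (inj₂ (inj₂ (inj₁ x)))) =
  crossing-rotate (crossing-rotate (h b<n x))
ascending⇒preservesCrossing f h a<n b<n c<n d<n (inj₁ (inj₂ (inj₂ (inj₂ x)))) = crossing-rotate (h c<n x)
ascending⇒preservesCrossing f h a<n b<n c<n d<n (inj₂ (inj₁ x)) = crossing-reverse (h a<n x)
ascending⇒preservesCrossing f h a<n b<n c<n d<n (inj₂ (inj₂ (inj₁ x))) =
  crossing-reverse (crossing-rotate (crossing-rotate (crossing-rotate (h d<n x))))
ascending⇒preservesCrossing f h a<n b<n c<n d<n (inj₂ (inj₂ (inj₂ (inj₁ x)))) =
  crossing-reverse (crossing-rotate (crossing-rotate (h c<n x)))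
ascending⇒preservesCrossing f h a<n b<n c<n d<n (inj₂ (inj₂ (inj₂ (inj₂ x)))) =
  crossing-reverse (crossing-rotate (h b<n x))

ascending⇒noCrossing : ∀ {E : ℕ → ℕ → Bool} → (∀ p q → E p q ≡ E q p) →
  (∀ {a b c d} → E a c ≡ true → E b d ≡ true → ¬ Ascending a b c d) →
  ∀ {a b c d} → E a c ≡ true → E b d ≡ true → ¬ Crossing a b c d
ascending⇒noCrossing {E} symmetric nc {a} {b} {c} {d} eac ebd = crossing⇒⊥
  where
  flip : ∀ {p q} → E p q ≡ true → E q p ≡ true
  flip {p} {q} e = trans (symmetric q p) e
  crossing⇒⊥ : ¬ Crossing a b c d
  crossing⇒⊥ (inj₁ (inj₁ x)) = nc eac ebd x
  crossing⇒⊥ (inj₁ (inj₂ (inj₁ x))) = nc ebd (flip eac) x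
  crossing⇒⊥ (inj₁ (inj₂ (inj₂ (inj₁ x)))) = nc (flip eac) (flip ebd) x
  crossing⇒⊥ (inj₁ (inj₂ (inj₂ (inj₂ x)))) = nc (flip ebd) eac x
  crossing⇒⊥ (inj₂ (inj₁ x)) = nc (flip ebd) (flip eac) x
  crossing⇒⊥ (inj₂ (inj₂ (inj₁ x))) = nc (flip eac) ebd x
  crossing⇒⊥ (inj₂ (inj₂ (inj₂ (inj₁ x)))) = nc ebd eac x
  crossing⇒⊥ (inj₂ (inj₂ (inj₂ (inj₂ x)))) = nc eac (flip ebd) x

-- A maximal outerplane graph with outer cycle 0, 1, …, n - 1, as an edge relation on ℕ that is false beyond n.
record Triangulation (n : ℕ) (E : ℕ → ℕ → Bool) : Set where
  field
    edge-< : ∀ {p q} → E p q ≡ true → p < n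
    symmetric : ∀ p q → E p q ≡ E q p
    irreflexive : ∀ p → E p p ≡ false
    noCrossing : ∀ {a b c d} → E a c ≡ true → E b d ≡ true → ¬ Crossing a b c d
    maximal : ∀ {p q} → p ≢ q → p < n → q < n →
      (∀ {a b} → E a b ≡ true → ¬ Crossing a p b q) → E p q ≡ true

  flip : ∀ {p q} → E p q ≡ true → E q p ≡ true
  flip {p} {q} e = trans (symmetric q p) e

  edge-<ʳ : ∀ {p q} → E p q ≡ true → q < n
  edge-<ʳ = edge-< ∘ flip

  noCrossing< : ∀ {a b c d} → E a c ≡ true → E b d ≡ true → a < b → b < c → c < d → ⊥
  noCrossing< eac ebd a<b b<c c<d = noCrossing eac ebd (inj₁ (inj₁ (a<b , b<c , c<d)))

  maximal< : ∀ {p q} → p < q → q < n →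
    (∀ {a b} → E a b ≡ true → a < p → p < b → b < q → ⊥) →
    (∀ {a b} → E a b ≡ true → p < a → a < q → q < b → ⊥) → E p q ≡ true
  maximal< p<q q<n left right = maximal (<⇒≢ p<q) (<-trans p<q q<n) q<n uncrossed
    where
    uncrossed : ∀ {a b} → E a b ≡ true → ¬ Crossing a _ b _
    uncrossed eab x with crossing-split x p<q
    ... | inj₁ (a<p , p<b , b<q) = left eab a<p p<b b<q
    ... | inj₂ (inj₁ (p<a , a<q , q<b)) = right eab p<a a<q q<b
    ... | inj₂ (inj₂ (inj₁ (b<p , p<a , a<q))) = left (flip eab) b<p p<a a<q
    ... | inj₂ (inj₂ (inj₂ (p<b , b<q , q<a))) = right (flip eab) p<b b<q q<a

  side : ∀ {p} → suc p < n → E p (suc p) ≡ true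
  side sp<n = maximal< ≤-refl sp<n (λ _ _ p<b b<sp → <⇒≱ p<b (s≤s⁻¹ b<sp))
    λ _ p<a a<sp _ → <⇒≱ p<a (s≤s⁻¹ a<sp)

  closingSide : ∀ {m} → n ≡ suc m → 0 < m → E 0 m ≡ true
  closingSide refl 0<m = maximal< 0<m ≤-refl (λ _ a<0 _ _ → n≮0 a<0)
    λ eab _ _ m<b → <⇒≱ m<b (s≤s⁻¹ (edge-<ʳ eab))

DegreeAtMost : ℕ → (ℕ → ℕ → Bool) → Set
DegreeAtMost k E = ∀ p {ns} → Unique ns → All (λ q → E p q ≡ true) ns → length ns ≤ k

fiveNeighbours⇒⊥ : ∀ {E p a b c d e} → DegreeAtMost 4 E → a < b → b < c → c < d → d < e →
  E p a ≡ true → E p b ≡ true → E p c ≡ true → E p d ≡ true → E p e ≡ true → ⊥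
fiveNeighbours⇒⊥ degree a<b b<c c<d d<e pa pb pc pd pe =
  <-irrefl refl (degree _ (ascending⇒unique (a<b ∷ b<c ∷ c<d ∷ d<e ∷ [-])) (pa ∷ pb ∷ pc ∷ pd ∷ pe ∷ []))

greatestBelow : (P : ℕ → Bool) → ∀ {lo hi} → P lo ≡ true → lo < hi →
  ∃ λ x → lo ≤ x × x < hi × P x ≡ true × (∀ {z} → x < z → z < hi → P z ≡ false)
greatestBelow P {lo} {suc h} Plo (s≤s lo≤h) with P h in Ph
... | true = h , lo≤h , ≤-refl , Ph , λ h<z z<sh → ⊥-elim (<⇒≱ h<z (s≤s⁻¹ z<sh))
... | false with m≤n⇒m<n∨m≡n lo≤h
...   | inj₂ refl = ⊥-elim (not-¬ Plo Ph)
...   | inj₁ lo<h with greatestBelow P Plo lo<h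
...     | x , lo≤x , x<h , Px , none-after = x , lo≤x , m≤n⇒m≤1+n x<h , Px , none-after′
  where
  none-after′ : ∀ {z} → x < z → z < suc h → P z ≡ false
  none-after′ {z} x<z z<sh with m≤n⇒m<n∨m≡n (s≤s⁻¹ z<sh)
  ... | inj₁ z<h = none-after x<z z<h
  ... | inj₂ refl = Ph

module _ {n : ℕ} {E : ℕ → ℕ → Bool} (T : Triangulation n E) where
  open Triangulation T

  -- The largest neighbour k of i below j will do: no chord can cross kj.
  apex : ∀ {i j} → E i j ≡ true → suc i < j → ∃ λ k → i < k × k < j × E i k ≡ true × E k j ≡ true
  apex {i} {j} eij si<j with greatestBelow (E i) (side (<-trans si<j (edge-<ʳ eij))) si<j
  ... | k , i<k , k<j , eik , none-after = k , i<k , k<j , eik , maximal< k<j (edge-<ʳ eij) left right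
    where
    left : ∀ {a b} → E a b ≡ true → a < k → k < b → b < j → ⊥
    left {a} eab a<k k<b b<j with <-cmp a i
    ... | tri< a<i _ _ = noCrossing< eab eij a<i (<-trans i<k k<b) b<j
    ... | tri≈ _ refl _ = not-¬ eab (none-after k<b b<j)
    ... | tri> _ _ i<a = noCrossing< eik eab i<a a<k k<b
    right : ∀ {a b} → E a b ≡ true → k < a → a < j → j < b → ⊥
    right eab k<a a<j j<b = noCrossing< eij eab (<-trans i<k k<a) a<j j<b

  IsEar : ℕ → Set
  IsEar e = suc e < n × (∀ {q} → E e q ≡ true → suc q ≡ e ⊎ q ≡ suc e)

  shortChord⇒ear : ∀ {i} → E i (2 + i) ≡ true → IsEar (suc i)
  shortChord⇒ear {i} e = edge-<ʳ e , neighbour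
    where
    neighbour : ∀ {q} → E (suc i) q ≡ true → suc q ≡ suc i ⊎ q ≡ 2 + i
    neighbour {q} eq with <-cmp q i | <-cmp q (2 + i)
    ... | tri≈ _ refl _ | _ = inj₁ refl
    ... | _ | tri≈ _ refl _ = inj₂ refl
    ... | tri< q<i _ _ | _ = ⊥-elim (noCrossing< (flip eq) e q<i ≤-refl ≤-refl)
    ... | _ | tri> _ _ 2+i<q = ⊥-elim (noCrossing< e eq ≤-refl ≤-refl 2+i<q)
    ... | tri> _ _ i<q | tri< q<2+i _ _ with ≤-antisym (s≤s⁻¹ q<2+i) i<q
    ...   | refl = ⊥-elim (not-¬ eq (irreflexive q))

  -- The triangle ikj on the chord ij has a shorter chord among ik, kj, or else i + 1 is an ear.
  earUnder : ∀ d {i j} → j ≤ i + d → E i j ≡ true → suc i < j → ∃ IsEar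
  earUnder zero {i} j≤i+0 _ si<j = ⊥-elim (<⇒≱ (<-trans (n<1+n i) si<j) (subst (_ ≤_) (+-identityʳ i) j≤i+0))
  earUnder (suc d) {i} {j} j≤i+sd eij si<j with apex eij si<j
  ... | k , i<k , k<j , eik , ekj with suc i <? k | suc k <? j
  ...   | yes si<k | _ = earUnder d (s≤s⁻¹ (≤-trans k<j (subst (j ≤_) (+-suc i d) j≤i+sd))) eik si<k
  ...   | no _ | yes sk<j = earUnder d (≤-trans j≤i+sd (subst (_≤ k + d) (sym (+-suc i d)) (+-monoˡ-≤ d i<k))) ekj sk<j
  ...   | no si≮k | no sk≮j with ≤-antisym (≮⇒≥ si≮k) i<k | ≤-antisym (≮⇒≥ sk≮j) k<j
  ...     | refl | refl = suc i , shortChord⇒ear eij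

  ear : ∀ {m} → n ≡ suc m → 1 < m → ∃ IsEar
  ear {m} refl 1<m = earUnder m ≤-refl (closingSide refl (<-trans z<s 1<m)) 1<m

record Bijection (n : ℕ) : Set where
  field
    to from : ℕ → ℕ
    to-< : ∀ {p} → p < n → to p < n
    from-< : ∀ {p} → p < n → from p < n
    from-to : ∀ {p} → p < n → from (to p) ≡ p
    to-from : ∀ {p} → p < n → to (from p) ≡ p

  to-injective : ∀ {p q} → p < n → q < n → to p ≡ to q → p ≡ q
  to-injective {p} {q} p<n q<n eq = trans (sym (from-to p<n)) (trans (cong from eq) (from-to q<n))

_∘ᵇ_ : ∀ {n} → Bijection n → Bijection n → Bijection n
B ∘ᵇ C = record
  { to = B.to ∘ C.to
  ; from = C.from ∘ B.from
  ; to-< = B.to-< ∘ C.to-<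
  ; from-< = C.from-< ∘ B.from-<
  ; from-to = λ p<n → trans (cong C.from (B.from-to (C.to-< p<n))) (C.from-to p<n)
  ; to-from = λ p<n → trans (cong B.to (C.to-from (B.from-< p<n))) (B.to-from p<n)
  }
  where
  module B = Bijection B
  module C = Bijection C

LinearLabelling : (n : ℕ) → (ℕ → ℕ → Bool) → Set
LinearLabelling n E = Σ (Bijection n) λ B →
  ∀ {L M} → L < n → M < n → E (Bijection.to B L) (Bijection.to B M) ≡ linAdjℕ L M

-- A permutation of the vertices 0, …, n - 1 of a convex polygon that preserves crossings of chords,
-- i.e. a rotation or a reflection.  It must keep ℕ ∖ [0, n) outside, where edge relations are false.
record Symmetry (n : ℕ) : Set where
  field
    bijection : Bijection n
  open Bijection bijection public
  field
    to-≥ : ∀ {p} → n ≤ p → n ≤ to p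
    to-crossing : PreservesCrossing n to
    from-crossing : PreservesCrossing n from

  to-<⁻¹ : ∀ {p} → to p < n → p < n
  to-<⁻¹ {p} top<n with p <? n
  ... | yes p<n = p<n
  ... | no p≮n = ⊥-elim (<⇒≱ top<n (to-≥ (≮⇒≥ p≮n)))

module _ {n : ℕ} {E : ℕ → ℕ → Bool} (S : Symmetry n) (T : Triangulation n E) where
  open Symmetry S
  open Triangulation T

  private
    E′ : ℕ → ℕ → Bool
    E′ = E on to

    edge-<′ : ∀ {p q} → E′ p q ≡ true → p < n
    edge-<′ = to-<⁻¹ ∘ edge-<

  triangulation-on : Triangulation n (E on to)
  triangulation-on = record
    { edge-< = edge-<′
    ; symmetric = λ p q → symmetric (to p) (to q)
    ; irreflexive = irreflexive ∘ to
    ; noCrossing = λ eac ebd x → noCrossing eac ebd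
        (to-crossing (edge-<′ eac) (edge-<′ ebd) (edge-<′ (flip eac)) (edge-<′ (flip ebd)) x)
    ; maximal = maximal′
    }
    where
    maximal′ : ∀ {p q} → p ≢ q → p < n → q < n →
      (∀ {a b} → E′ a b ≡ true → ¬ Crossing a p b q) → E′ p q ≡ true
    maximal′ {p} {q} p≢q p<n q<n uncrossed =
      maximal (p≢q ∘ to-injective p<n q<n) (to-< p<n) (to-< q<n) uncrossedᵗᵒ
      where
      uncrossedᵗᵒ : ∀ {A B} → E A B ≡ true → ¬ Crossing A (to p) B (to q)
      uncrossedᵗᵒ {A} {B} eAB x = uncrossed eAB′ x′
        where
        A<n : A < n
        A<n = edge-< eAB
        B<n : B < n
        B<n = edge-<ʳ eAB
        eAB′ : E′ (from A) (from B) ≡ true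
        eAB′ = subst₂ (λ A′ B′ → E A′ B′ ≡ true) (sym (to-from A<n)) (sym (to-from B<n)) eAB
        x′ : Crossing (from A) p (from B) q
        x′ = subst₂ (λ p′ q′ → Crossing (from A) p′ (from B) q′) (from-to p<n) (from-to q<n)
          (from-crossing A<n (to-< p<n) B<n (to-< q<n) x)

  degreeAtMost-on : ∀ {k} → DegreeAtMost k E → DegreeAtMost k (E on to)
  degreeAtMost-on {k} degree p {ns} ns! adjacent = subst (_≤ k) (length-map to ns)
    (degree (to p) (unique-map⁺ to-injective ns<n ns!) (All.map⁺ adjacent))
    where
    ns<n : All (_< n) ns
    ns<n = All.map (edge-<′ ∘ flip) adjacent

rotate : ℕ → ℕ → ℕ → ℕ
rotate n e p with p <? n | p + e <? n
... | no _ | _ = p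
... | yes _ | yes _ = p + e
... | yes _ | no _ = p + e ∸ n

module Rotation (n e : ℕ) (e≤n : e ≤ n) where

  rotate-≥ : ∀ {p} → n ≤ p → rotate n e p ≡ p
  rotate-≥ {p} n≤p with p <? n
  ... | yes p<n = ⊥-elim (<⇒≱ p<n n≤p)
  ... | no _ = refl

  rotate-unwrapped : ∀ {p} → p + e < n → rotate n e p ≡ p + e
  rotate-unwrapped {p} p+e<n with p <? n | p + e <? n
  ... | yes _ | yes _ = refl
  ... | yes _ | no p+e≮n = ⊥-elim (p+e≮n p+e<n)
  ... | no p≮n | _ = ⊥-elim (p≮n (≤-<-trans (m≤m+n p e) p+e<n))

  rotate-wrapped : ∀ {p} → p < n → n ≤ p + e → rotate n e p + n ≡ p + e
  rotate-wrapped {p} p<n n≤p+e with p <? n | p + e <? n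
  ... | yes _ | yes p+e<n = ⊥-elim (<⇒≱ p+e<n n≤p+e)
  ... | yes _ | no _ = m∸n+n≡m n≤p+e
  ... | no p≮n | _ = ⊥-elim (p≮n p<n)

  wraps? : ∀ p → p + e < n ⊎ n ≤ p + e
  wraps? p with p + e <? n
  ... | yes p+e<n = inj₁ p+e<n
  ... | no p+e≮n = inj₂ (≮⇒≥ p+e≮n)

  rotate-< : ∀ {p} → p < n → rotate n e p < n
  rotate-< {p} p<n with wraps? p
  ... | inj₁ p+e<n = subst (_< n) (sym (rotate-unwrapped p+e<n)) p+e<n
  ... | inj₂ n≤p+e = +-cancelʳ-< n (rotate n e p) n
    (subst (_< n + n) (sym (rotate-wrapped p<n n≤p+e)) (+-mono-<-≤ p<n e≤n))

  rotate-≥′ : ∀ {p} → n ≤ p → n ≤ rotate n e p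
  rotate-≥′ n≤p = subst (n ≤_) (sym (rotate-≥ n≤p)) n≤p

  private
    unwrapped-< : ∀ {x y} → x < y → y + e < n → rotate n e x < rotate n e y
    unwrapped-< x<y y+e<n = subst₂ _<_
      (sym (rotate-unwrapped (≤-<-trans (+-monoˡ-≤ e (<⇒≤ x<y)) y+e<n))) (sym (rotate-unwrapped y+e<n))
      (+-monoˡ-< e x<y)

    wrapped-< : ∀ {x y} → x < y → y < n → n ≤ x + e → rotate n e x < rotate n e y
    wrapped-< x<y y<n n≤x+e = +-cancelʳ-< n _ _ (subst₂ _<_
      (sym (rotate-wrapped (<-trans x<y y<n) n≤x+e))
      (sym (rotate-wrapped y<n (≤-trans n≤x+e (+-monoˡ-≤ e (<⇒≤ x<y)))))
      (+-monoˡ-< e x<y))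

    wrapped<unwrapped : ∀ {x y} → x + e < n → y < n → n ≤ y + e → rotate n e y < rotate n e x
    wrapped<unwrapped {x} {y} x+e<n y<n n≤y+e = +-cancelʳ-< n _ _ (subst₂ _<_
      (sym (rotate-wrapped y<n n≤y+e)) (cong (_+ n) (sym (rotate-unwrapped x+e<n)))
      (subst (y + e <_) (+-comm n (x + e)) (+-mono-<-≤ y<n (m≤n+m e x))))

    below : ∀ {x y} → x < y → y + e < n → x + e < n
    below x<y y+e<n = ≤-<-trans (+-monoˡ-≤ e (<⇒≤ x<y)) y+e<n


  -- The points that wrap around form a final segment of a < b < c < d.
  rotate-ascending : ∀ {a b c d} → d < n → Ascending a b c d →
    Crossing (rotate n e a) (rotate n e b) (rotate n e c) (rotate n e d)
  rotate-ascending {a} {b} {c} {d} d<n (a<b , b<c , c<d) with wraps? a | wraps? b | wraps? c | wraps? d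
  ... | _ | _ | _ | inj₁ d′ = inj₁ (inj₁
        (unwrapped-< a<b (below (<-trans b<c c<d) d′) , unwrapped-< b<c (below c<d d′) , unwrapped-< c<d d′))
  ... | _ | _ | inj₁ c′ | inj₂ d′ = inj₁ (inj₂ (inj₂ (inj₂
        (wrapped<unwrapped (below (<-trans a<b b<c) c′) d<n d′ , unwrapped-< a<b (below b<c c′) , unwrapped-< b<c c′))))
  ... | _ | inj₁ b′ | inj₂ c′ | inj₂ d′ = inj₁ (inj₂ (inj₂ (inj₁
        (wrapped-< c<d d<n c′ , wrapped<unwrapped (below a<b b′) d<n d′ , unwrapped-< a<b b′))))
  ... | inj₁ a′ | inj₂ b′ | inj₂ c′ | inj₂ d′ = inj₁ (inj₂ (inj₁
        (wrapped-< b<c c<n b′ , wrapped-< c<d d<n c′ , wrapped<unwrapped a′ d<n d′)))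
    where
    c<n : c < n
    c<n = <-trans c<d d<n
  ... | inj₂ a′ | inj₂ b′ | inj₂ c′ | inj₂ d′ = inj₁ (inj₁
        (wrapped-< a<b (<-trans b<c c<n) a′ , wrapped-< b<c c<n b′ , wrapped-< c<d d<n c′))
    where
    c<n : c < n
    c<n = <-trans c<d d<n

module _ {n e e′ : ℕ} (e+e′≡n : e + e′ ≡ n) where
  private
    module R = Rotation n e (subst (e ≤_) e+e′≡n (m≤m+n e e′))
    module R′ = Rotation n e′ (subst (e′ ≤_) (trans (+-comm e′ e) e+e′≡n) (m≤m+n e′ e))

  rotate-inverse : ∀ {p} → p < n → rotate n e′ (rotate n e p) ≡ p
  rotate-inverse {p} p<n with R.wraps? p
  ... | inj₁ p+e<n = +-cancelʳ-≡ n _ _ (trans (R′.rotate-wrapped (R.rotate-< p<n) n≤r+e′) r+e′≡p+n)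
    where
    r+e′≡p+n : rotate n e p + e′ ≡ p + n
    r+e′≡p+n = begin
      rotate n e p + e′ ≡⟨ cong (_+ e′) (R.rotate-unwrapped p+e<n) ⟩
      p + e + e′        ≡⟨ +-assoc p e e′ ⟩
      p + (e + e′)      ≡⟨ cong (p +_) e+e′≡n ⟩
      p + n             ∎
      where open ≡-Reasoning
    n≤r+e′ : n ≤ rotate n e p + e′
    n≤r+e′ = subst (n ≤_) (sym r+e′≡p+n) (m≤n+m n p)
  ... | inj₂ n≤p+e = trans (R′.rotate-unwrapped (subst (_< n) (sym r+e′≡p) p<n)) r+e′≡p
    where
    r+e′≡p : rotate n e p + e′ ≡ p
    r+e′≡p = +-cancelʳ-≡ e _ _ (begin
      rotate n e p + e′ + e   ≡⟨ +-assoc (rotate n e p) e′ e ⟩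
      rotate n e p + (e′ + e) ≡⟨ cong (rotate n e p +_) (trans (+-comm e′ e) e+e′≡n) ⟩
      rotate n e p + n        ≡⟨ R.rotate-wrapped p<n n≤p+e ⟩
      p + e                   ∎)
      where open ≡-Reasoning

rotation : ∀ n e e′ → e + e′ ≡ n → Symmetry n
rotation n e e′ e+e′≡n = record
  { bijection = record
    { to = rotate n e
    ; from = rotate n e′
    ; to-< = R.rotate-<
    ; from-< = R′.rotate-<
    ; from-to = rotate-inverse e+e′≡n
    ; to-from = rotate-inverse e′+e≡n
    }
  ; to-≥ = R.rotate-≥′
  ; to-crossing = ascending⇒preservesCrossing (rotate n e) R.rotate-ascending
  ; from-crossing = ascending⇒preservesCrossing (rotate n e′) R′.rotate-ascending
  }
  where
  e′+e≡n : e′ + e ≡ n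
  e′+e≡n = trans (+-comm e′ e) e+e′≡n
  module R = Rotation n e (subst (e ≤_) e+e′≡n (m≤m+n e e′))
  module R′ = Rotation n e′ (subst (e′ ≤_) e′+e≡n (m≤m+n e′ e))

reflect : ℕ → ℕ → ℕ
reflect n zero = zero
reflect n (suc p) with suc p <? n
... | yes _ = n ∸ suc p
... | no _ = suc p

module Reflection (n : ℕ) where

  reflect-inner : ∀ {p} → 0 < p → p < n → reflect n p ≡ n ∸ p
  reflect-inner {suc p} _ sp<n with suc p <? n
  ... | yes _ = refl
  ... | no sp≮n = ⊥-elim (sp≮n sp<n)

  reflect-≥ : ∀ {p} → n ≤ p → reflect n p ≡ p
  reflect-≥ {zero} _ = refl
  reflect-≥ {suc p} n≤sp with suc p <? n
  ... | yes sp<n = ⊥-elim (<⇒≱ sp<n n≤sp)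
  ... | no _ = refl

  reflect-≥′ : ∀ {p} → n ≤ p → n ≤ reflect n p
  reflect-≥′ n≤p = subst (n ≤_) (sym (reflect-≥ n≤p)) n≤p

  reflect-< : ∀ {p} → p < n → reflect n p < n
  reflect-< {zero} 0<n = 0<n
  reflect-< {suc p} sp<n = subst (_< n) (sym (reflect-inner z<s sp<n)) (∸-monoʳ-< {n} {suc p} {0} z<s (<⇒≤ sp<n))

  reflect-involutive : ∀ {p} → p < n → reflect n (reflect n p) ≡ p
  reflect-involutive {zero} _ = refl
  reflect-involutive {suc p} sp<n rewrite reflect-inner z<s sp<n = trans
    (reflect-inner (m<n⇒0<n∸m sp<n) (∸-monoʳ-< {n} {suc p} {0} z<s (<⇒≤ sp<n)))
    (m∸[m∸n]≡n (<⇒≤ sp<n))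

  reflect-antitone : ∀ {x y} → 0 < x → x < y → y < n → reflect n y < reflect n x
  reflect-antitone 0<x x<y y<n
    rewrite reflect-inner 0<x (<-trans x<y y<n) | reflect-inner (<-trans 0<x x<y) y<n = ∸-monoʳ-< x<y (<⇒≤ y<n)

  reflect-ascending : ∀ {a b c d} → d < n → Ascending a b c d →
    Crossing (reflect n a) (reflect n b) (reflect n c) (reflect n d)
  reflect-ascending {zero} {b} {c} {d} d<n (a<b , b<c , c<d) = inj₂ (inj₂ (inj₂ (inj₂
    ( subst (0 <_) (sym (reflect-inner 0<d d<n)) (m<n⇒0<n∸m d<n)
    , reflect-antitone (<-trans a<b b<c) c<d d<n
    , reflect-antitone a<b b<c (<-trans c<d d<n)))))
    where
    0<d : 0 < d
    0<d = <-trans a<b (<-trans b<c c<d)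
  reflect-ascending {suc a} d<n (a<b , b<c , c<d) = inj₂ (inj₁
    ( reflect-antitone (<-trans z<s (<-trans a<b b<c)) c<d d<n
    , reflect-antitone (<-trans z<s a<b) b<c (<-trans c<d d<n)
    , reflect-antitone z<s a<b (<-trans b<c (<-trans c<d d<n))))

reflection : ∀ n → Symmetry n
reflection n = record
  { bijection = record
    { to = reflect n
    ; from = reflect n
    ; to-< = reflect-<
    ; from-< = reflect-<
    ; from-to = reflect-involutive
    ; to-from = reflect-involutive
    }
  ; to-≥ = reflect-≥′
  ; to-crossing = ascending⇒preservesCrossing (reflect n) reflect-ascending
  ; from-crossing = ascending⇒preservesCrossing (reflect n) reflect-ascending
  }
  where open Reflection n

double : ℕ → ℕ
double zero = zero
double (suc k) = suc (suc (double k))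

double≡+ : ∀ k → double k ≡ k + k
double≡+ zero = refl
double≡+ (suc k) = cong suc (trans (cong suc (double≡+ k)) (sym (+-suc k k)))

≢0∧≢1∧≢2⇒2< : ∀ {x} → x ≢ 0 → x ≢ 1 → x ≢ 2 → 2 < x
≢0∧≢1∧≢2⇒2< {0} x≢0 _ _ = ⊥-elim (x≢0 refl)
≢0∧≢1∧≢2⇒2< {1} _ x≢1 _ = ⊥-elim (x≢1 refl)
≢0∧≢1∧≢2⇒2< {2} _ _ x≢2 = ⊥-elim (x≢2 refl)
≢0∧≢1∧≢2⇒2< {suc (suc (suc _))} _ _ _ = s≤s (s≤s (s≤s z≤n))

k≤double : ∀ k → k ≤ double k
k≤double k = subst (k ≤_) (sym (double≡+ k)) (m≤m+n k k)

+<⇒<∸ : ∀ a {b n} → a + b < n → b < n ∸ a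
+<⇒<∸ a {b} a+b<n = +-cancelˡ-< a b _ (subst (a + b <_) (sym (m+[n∸m]≡n (m+n≤o⇒m≤o a (<⇒≤ a+b<n)))) a+b<n)

data OddEven : ℕ → Set where
  zero : OddEven 0
  odd : ∀ k → OddEven (1 + double k)
  even : ∀ k → OddEven (2 + double k)

oddEven : ∀ L → OddEven L
oddEven zero = zero
oddEven (suc L) with oddEven L
... | zero = odd 0
... | odd k = even k
... | even k = odd (suc k)

oddEven-odd : ∀ k → oddEven (1 + double k) ≡ odd k
oddEven-even : ∀ k → oddEven (2 + double k) ≡ even k
oddEven-odd zero = refl
oddEven-odd (suc k) rewrite oddEven-even k = refl
oddEven-even k rewrite oddEven-odd k = refl

-- The zigzag drawing of the straight linear 2-tree: v₀, v₁, v₂, v₃, v₄, … sit at positions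
-- 0, 1, n - 1, 2, n - 2, …, and label inverts position.
module ZigzagLabels (n : ℕ) where

  positionᵛ : ∀ {L} → OddEven L → ℕ
  positionᵛ zero = 0
  positionᵛ (odd k) = suc k
  positionᵛ (even k) = n ∸ suc k

  position : ℕ → ℕ
  position L = positionᵛ (oddEven L)

  label : ℕ → ℕ
  label zero = zero
  label (suc p) with double (suc p) ≤? n
  ... | yes _ = suc (double p)
  ... | no _ = double (n ∸ suc p)

  position-odd : ∀ k → position (1 + double k) ≡ suc k
  position-odd k rewrite oddEven-odd k = refl

  position-even : ∀ k → position (2 + double k) ≡ n ∸ suc k
  position-even k rewrite oddEven-even k = refl

  label-low : ∀ {p} → double (suc p) ≤ n → label (suc p) ≡ suc (double p)
  label-low {p} low with double (suc p) ≤? n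
  ... | yes _ = refl
  ... | no high = ⊥-elim (high low)

  label-high : ∀ {q} → 0 < q → n < double q → label q ≡ double (n ∸ q)
  label-high {suc p} _ high with double (suc p) ≤? n
  ... | yes low = ⊥-elim (<⇒≱ high low)
  ... | no _ = refl

  position-double : ∀ {q} → 0 < q → position (double q) ≡ n ∸ q
  position-double {suc t} _ = position-even t

  private
    double-complement-large : ∀ {q} → q ≤ n → double q < n → n < double (n ∸ q)
    double-complement-large {q} q≤n 2q<n = subst₂ _<_ (m∸n+n≡m q≤n) (sym (double≡+ (n ∸ q)))
      (+-monoʳ-< (n ∸ q) (+-cancelˡ-< q q (n ∸ q) (subst₂ _<_ (double≡+ q) (sym (m+[n∸m]≡n q≤n)) 2q<n)))

    double-complement-small : ∀ {q} → q ≤ n → n < double q → double (n ∸ q) < n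
    double-complement-small {q} q≤n n<2q = subst₂ _<_ (sym (double≡+ (n ∸ q))) (m∸n+n≡m q≤n)
      (+-monoʳ-< (n ∸ q) (+-cancelʳ-< q (n ∸ q) q (subst₂ _<_ (sym (m∸n+n≡m q≤n)) (double≡+ q) n<2q)))

  position-< : ∀ {L} → L < n → position L < n
  position-< {L} L<n with oddEven L
  ... | zero = L<n
  ... | odd k = ≤-<-trans (s≤s (k≤double k)) L<n
  ... | even k = ∸-monoʳ-< {n} {suc k} {0} z<s (≤-trans (s≤s (k≤double k)) (<⇒≤ (<-trans (n<1+n _) L<n)))

  label-< : ∀ {p} → p < n → label p < n
  label-< {zero} 0<n = 0<n
  label-< {suc p} p<n with double (suc p) ≤? n
  ... | yes low = low
  ... | no high = double-complement-small (<⇒≤ p<n) (≰⇒> high)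

  label-position : ∀ {L} → L < n → label (position L) ≡ L
  label-position {L} L<n with oddEven L
  ... | zero = refl
  ... | odd k = label-low L<n
  ... | even k = trans (label-high (m<n⇒0<n∸m k+1<n) (double-complement-large (<⇒≤ k+1<n) L<n))
                       (cong double (m∸[m∸n]≡n (<⇒≤ k+1<n)))
    where
    k+1<n : suc k < n
    k+1<n = ≤-<-trans (s≤s (k≤double k)) (<-trans (n<1+n _) L<n)

  position-label : ∀ {p} → p < n → position (label p) ≡ p
  position-label {zero} _ = refl
  position-label {suc p} p<n with double (suc p) ≤? n
  ... | yes _ = position-odd p
  ... | no high = trans (position-double (m<n⇒0<n∸m p<n)) (m∸[m∸n]≡n (<⇒≤ p<n))

  labels : Bijection n
  labels = record
    { to = position ; from = label ; to-< = position-< ; from-< = label-<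
    ; from-to = label-position ; to-from = position-label }

module Zigzag {l : ℕ} {E : ℕ → ℕ → Bool} (T : Triangulation (2 + l) E) (degree : DegreeAtMost 4 E) (5≤l : 5 ≤ l)
  (ear₀ : ∀ {q} → E 0 q ≡ true → q ≡ 1 ⊎ q ≡ suc l) where
  open Triangulation T

  private
    n m : ℕ
    n = 2 + l
    m = suc l

    m≥6 : 6 ≤ m
    m≥6 = s≤s 5≤l

    lift : ∀ {k} → k ≤ 6 → k ≤ m
    lift k≤6 = ≤-trans k≤6 m≥6

    small : ∀ {k} → k ≤ 6 → k < n
    small k≤6 = s≤s (lift k≤6)

  E0m : E 0 m ≡ true
  E0m = closingSide refl (lift z<s)

  E1m : E 1 m ≡ true
  E1m = maximal< (lift (s≤s (s≤s z≤n))) ≤-refl left (λ eab _ _ m<b → <⇒≱ m<b (s≤s⁻¹ (edge-<ʳ eab)))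
    where
    left : ∀ {a b} → E a b ≡ true → a < 1 → 1 < b → b < m → ⊥
    left {zero} e0b _ 1<b b<m with ear₀ e0b
    ... | inj₁ refl = <-irrefl refl 1<b
    ... | inj₂ refl = <-irrefl refl b<m
    left {suc _} _ (s≤s ()) _ _

  private
    ≤l⇒<n : ∀ {k} → k ≤ l → k < n
    ≤l⇒<n k≤l = s≤s (m≤n⇒m≤1+n k≤l)

    smallSide : ∀ {p} → suc p ≤ 6 → E p (suc p) ≡ true
    smallSide sp≤6 = side (s≤s (lift sp≤6))

    noApexBetween : ∀ {x} → 2 < x → x < l → E 1 x ≡ true → E x m ≡ true → ⊥
    noApexBetween {suc w} 2<x x<l e1x exm with apex T e1x 2<x
    ... | y , 1<y , y<x , e1y , eyx with m≤n⇒m<n∨m≡n (s≤s⁻¹ y<x)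
    ...   | inj₁ y<w = fiveNeighbours⇒⊥ {E} degree 1<y y<w (m≤n⇒m≤1+n (n<1+n w)) (s≤s x<l)
            (flip e1x) (flip eyx) (flip (side (≤l⇒<n (<⇒≤ x<l)))) (side (≤l⇒<n x<l)) exm
    ...   | inj₂ refl with m≤n⇒m<n∨m≡n (s≤s⁻¹ 2<x)
    ...     | inj₁ 2<y = fiveNeighbours⇒⊥ {E} degree (s≤s z≤n) 2<y (n<1+n y) (m≤n⇒m≤1+n x<l)
              (flip (smallSide (s≤s z≤n))) (smallSide (s≤s (s≤s z≤n))) e1y e1x E1m
    ...     | inj₂ refl with apex T exm (lift (n≤1+n 5))
    ...       | z , 3<z , z<m , e3z , ezm with m≤n⇒m<n∨m≡n 3<z
    ...         | inj₁ 4<z = fiveNeighbours⇒⊥ {E} degree ≤-refl (s≤s (s≤s (s≤s z≤n))) 4<z z<m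
                  (flip e1x) (flip (smallSide (s≤s (s≤s (s≤s z≤n))))) (smallSide (s≤s (s≤s (s≤s (s≤s z≤n)))))
                  e3z exm
    ...         | inj₂ refl = fiveNeighbours⇒⊥ {E} degree z<s (s≤s (s≤s z≤n)) ≤-refl 5≤l
                  (flip E0m) (flip E1m) (flip exm) (flip ezm) (flip (side ≤-refl))

  orientation : E 2 m ≡ true ⊎ E 1 l ≡ true
  orientation with apex T E1m (lift (s≤s (s≤s (s≤s z≤n))))
  ... | x , 1<x , x<m , e1x , exm with m≤n⇒m<n∨m≡n 1<x | m≤n⇒m<n∨m≡n (s≤s⁻¹ x<m)
  ...   | inj₂ refl | _ = inj₁ exm
  ...   | _ | inj₂ refl = inj₂ e1x
  ...   | inj₁ 2<x | inj₁ x<l = ⊥-elim (noApexBetween 2<x x<l e1x exm)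

  module Oriented (E2m : E 2 m ≡ true) where

    -- For K + j = n these are the rungs K(n - K) and (K + 1)(n - K).
    Rungs : ℕ → ℕ → Set
    Rungs K j = (K < j → E K j ≡ true) × (suc K < j → E (suc K) j ≡ true)

    private
      -- The vertex j + 1 would have the five neighbours k + 1, k + 2, k′, j and j + 2 (or 0 if j + 1 = m).
      crowded : ∀ k {j k′} → suc (suc k) + j ≡ n → suc (suc k) < k′ → k′ < j →
        E (suc k) (suc j) ≡ true → E (suc (suc k)) (suc j) ≡ true → E k′ (suc j) ≡ true → ⊥
      crowded zero refl 2<k′ k′<l e₁ e₂ ek′ = fiveNeighbours⇒⊥ {E} degree z<s ≤-refl 2<k′ k′<l
        (flip E0m) (flip e₁) (flip e₂) (flip ek′) (flip (side ≤-refl))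
      crowded (suc k) {j} eq K+1<k′ k′<j e₁ e₂ ek′ =
        fiveNeighbours⇒⊥ {E} degree ≤-refl K+1<k′ k′<j (n≤1+n (suc j))
        (flip e₁) (flip e₂) (flip ek′) (flip (side (<-trans (n<1+n (suc j)) j+2<n))) (side j+2<n)
        where
        j+2<n : 2 + j < n
        j+2<n = subst (2 + j <_) eq (s≤s (s≤s (s≤s (m≤n+m j k))))

      nextRungs : ∀ k {j} → suc (suc k) + j ≡ n → Rungs (suc k) (suc j) → Rungs (suc (suc k)) j
      nextRungs k {j} eq (r₁ , r₂) = rung₁ , rung₂
        where
        rung₁ : suc (suc k) < j → E (suc (suc k)) j ≡ true
        rung₁ K+1<j with r₂ (m<n⇒m<1+n K+1<j)
        ... | e₂ with apex T e₂ (s≤s K+1<j)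
        ...   | k′ , K+1<k′ , k′<j+1 , eKk′ , ek′ with m≤n⇒m<n∨m≡n (s≤s⁻¹ k′<j+1)
        ...     | inj₁ k′<j =
                  ⊥-elim (crowded k eq K+1<k′ k′<j (r₁ (<-trans (n<1+n _) (m<n⇒m<1+n K+1<j))) e₂ ek′)
        ...     | inj₂ refl = eKk′
        rung₂ : suc (suc (suc k)) < j → E (suc (suc (suc k))) j ≡ true
        rung₂ K+2<j with rung₁ (<-trans (n<1+n _) K+2<j)
        ... | e with apex T e K+2<j
        ...   | k′ , K+1<k′ , k′<j , eKk′ , ek′j with m≤n⇒m<n∨m≡n K+1<k′
        ...     | inj₂ refl = ek′j
        ...     | inj₁ K+2<k′ = ⊥-elim (fiveNeighbours⇒⊥ {E} degree
                  (m<n⇒m<1+n (n<1+n (suc k))) K+2<k′ k′<j (n<1+n j)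
                  (flip (side (<-trans (n<1+n _) K+1<n))) (side K+1<n) eKk′ e
                  (r₂ (m<n⇒m<1+n (<-trans (n<1+n _) K+2<j))))
          where
          K+1<n : 3 + k < n
          K+1<n = <-trans K+2<j (edge-<ʳ e)

    rungs : ∀ k {j} → suc k + j ≡ n → Rungs (suc k) j
    rungs zero refl = (λ _ → E1m) , (λ _ → E2m)
    rungs (suc k) {j} eq = nextRungs k eq (rungs k (trans (+-suc (suc k) j) eq))

    open ZigzagLabels n
    open Bijection labels using (to-injective)

    rung₁ : ∀ k → 2 + double k < n → E (suc k) (n ∸ suc k) ≡ true
    rung₁ k 2k+2<n = proj₁ (rungs k (m+[n∸m]≡n {suc k} {n} (m+n≤o⇒m≤o (suc k) (<⇒≤ k+1+k+1<n))))
      (+<⇒<∸ (suc k) k+1+k+1<n)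
      where
      k+1+k+1<n : suc k + suc k < n
      k+1+k+1<n = subst (_< n) (double≡+ (suc k)) 2k+2<n

    rung₂ : ∀ k → 3 + double k < n → E (2 + k) (n ∸ suc k) ≡ true
    rung₂ k 2k+3<n = proj₂ (rungs k (m+[n∸m]≡n {suc k} {n} (m+n≤o⇒m≤o (suc k) (<⇒≤ k+1+k+2<n))))
      (+<⇒<∸ (suc k) k+1+k+2<n)
      where
      k+1+k+2<n : suc k + (2 + k) < n
      k+1+k+2<n = subst (_< n) (trans (cong suc (double≡+ (suc k))) (sym (+-suc (suc k) (suc k)))) 2k+3<n

    edge+1 : ∀ {L} → suc L < n → E (position L) (position (1 + L)) ≡ true
    edge+1 {L} L+1<n with oddEven L
    ... | zero = side L+1<n
    ... | odd k = rung₁ k L+1<n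
    ... | even k = flip (rung₂ k L+1<n)

    edge+2 : ∀ {L} → 2 + L < n → E (position L) (position (2 + L)) ≡ true
    edge+2 {L} L+2<n with oddEven L
    ... | zero = E0m
    ... | odd k = side (≤-<-trans (s≤s (s≤s (k≤double k))) (<-trans (n<1+n _) L+2<n))
    ... | even k =
      subst (λ x → E x (n ∸ (2 + k)) ≡ true) (sym (+-∸-assoc 1 k+2≤n))
        (flip (side (subst (_< n) (+-∸-assoc 1 k+2≤n) (∸-monoʳ-< {n} {suc k} {0} z<s (<⇒≤ k+2≤n)))))
      where
      k+2≤n : 2 + k ≤ n
      k+2≤n = ≤-trans (s≤s (s≤s (k≤double k))) (<⇒≤ (<-trans (n<1+n _) (<-trans (n<1+n _) L+2<n)))

    -- v₀ is the ear, an edge from v₁ = 1 past 2 would cross the chord 2m, and every other v_L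
    -- already has the four neighbours v_{L±1}, v_{L±2}.
    farEdge⇒⊥ : ∀ {L M} → 3 + L ≤ M → M < n → E (position L) (position M) ≡ true → ⊥
    farEdge⇒⊥ {zero} {M} 3≤M M<n e with ear₀ e
    ... | inj₁ pM≡1 =
      <⇒≢ (≤-trans (s≤s (s≤s z≤n)) 3≤M) (sym (to-injective {M} {1} M<n (small (s≤s z≤n)) pM≡1))
    ... | inj₂ pM≡m = <⇒≢ 3≤M (sym (to-injective {M} {2} M<n (small (s≤s (s≤s z≤n))) pM≡m))
    farEdge⇒⊥ {1} {M} 4≤M M<n e = noCrossing< e E2m ≤-refl
      (≢0∧≢1∧≢2⇒2< (away 0 z≤n) (away 1 (s≤s z≤n)) (away 3 (s≤s (s≤s (s≤s z≤n)))))
      (≤∧≢⇒< (s≤s⁻¹ (position-< M<n)) (away 2 (s≤s (s≤s z≤n))))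
      where
      away : ∀ K → K ≤ 3 → position M ≢ position K
      away K K≤3 pM≡pK = <⇒≢ K<M (sym (to-injective {M} {K} M<n (<-trans K<M M<n) pM≡pK))
        where
        K<M : K < M
        K<M = ≤-trans (s≤s K≤3) 4≤M
    farEdge⇒⊥ {suc (suc L)} {M} L+5≤M M<n e = <-irrefl refl (degree _
      (unique-map⁺ {f = position} to-injective ranges
        (ascending⇒unique (n<1+n L ∷ m<n⇒m<1+n (n<1+n (suc L)) ∷ n<1+n _ ∷ L+5≤M ∷ [-])))
      (All.map⁺ adjacent))
      where
      L+4<n : 4 + L < n
      L+4<n = <-trans L+5≤M M<n
      L+3<n : 3 + L < n
      L+3<n = <-trans (n<1+n _) L+4<n
      L+2<n : 2 + L < n
      L+2<n = <-trans (n<1+n _) L+3<n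
      adjacent : All (λ K → E (position (2 + L)) (position K) ≡ true) (L ∷ 1 + L ∷ 3 + L ∷ 4 + L ∷ M ∷ [])
      adjacent = flip (edge+2 L+2<n) ∷ flip (edge+1 L+2<n) ∷ edge+1 L+3<n ∷ edge+2 L+4<n ∷ e ∷ []
      ranges : All (_< n) (L ∷ 1 + L ∷ 3 + L ∷ 4 + L ∷ M ∷ [])
      ranges = <-trans (m<n⇒m<1+n (n<1+n L)) L+2<n ∷ <-trans (n<1+n _) L+2<n ∷ L+3<n ∷ L+4<n ∷ M<n ∷ []

    private
      edgeAbove : ∀ L d → L + d < n → 0 < d → E (position L) (position (L + d)) ≡ linAdjℕ L (L + d)
      edgeAbove L 1 L+1<n _ rewrite ∣m-m+n∣≡n L 1 | +-comm L 1 = edge+1 L+1<n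
      edgeAbove L 2 L+2<n _ rewrite ∣m-m+n∣≡n L 2 | +-comm L 2 = edge+2 L+2<n
      edgeAbove L (suc (suc (suc d))) L+d<n _ rewrite ∣m-m+n∣≡n L (3 + d) =
        ¬-not (farEdge⇒⊥ (≤-trans (≤-reflexive (+-comm 3 L)) (+-monoʳ-≤ L (m≤m+n 3 d))) L+d<n)

    labelling : ∀ {L M} → L < n → M < n → E (position L) (position M) ≡ linAdjℕ L M
    labelling {L} {M} L<n M<n with <-cmp L M
    ... | tri≈ _ refl _ rewrite ∣n-n∣≡0 L = irreflexive (position L)
    ... | tri< L<M _ _ with m≤n⇒∃[o]m+o≡n (<⇒≤ L<M)
    ...   | d , refl = edgeAbove L d M<n (n≢0⇒n>0 λ { refl → <-irrefl (sym (+-identityʳ L)) L<M })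
    labelling {L} {M} L<n M<n | tri> _ _ M<L with m≤n⇒∃[o]m+o≡n (<⇒≤ M<L)
    ...   | d , refl = trans (symmetric _ _)
      (trans (edgeAbove M d L<n (n≢0⇒n>0 λ { refl → <-irrefl (sym (+-identityʳ M)) M<L })) (linAdjℕ-comm M (M + d)))

module _ {l : ℕ} {E : ℕ → ℕ → Bool} (T : Triangulation (2 + l) E) (degree : DegreeAtMost 4 E) (5≤l : 5 ≤ l) where
  private
    n m : ℕ
    n = 2 + l
    m = suc l

    Normalised : (ℕ → ℕ → Bool) → Set
    Normalised E′ =
      Triangulation n E′ × DegreeAtMost 4 E′ × (∀ {q} → E′ 0 q ≡ true → q ≡ 1 ⊎ q ≡ m) × E′ 2 m ≡ true

    labelled : (B : Bijection n) → Normalised (E on Bijection.to B) → LinearLabelling n E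
    labelled B (T′ , degree′ , ear₀ , E2m) =
      B ∘ᵇ ZigzagLabels.labels n , Zigzag.Oriented.labelling T′ degree′ 5≤l ear₀ E2m

  private module Rotated {e} (isEar : IsEar T e) where
    e+1<n : suc e < n
    e+1<n = proj₁ isEar

    e≤n : e ≤ n
    e≤n = <⇒≤ (<-trans (n<1+n e) e+1<n)

    R : Symmetry n
    R = rotation n e (n ∸ e) (m+[n∸m]≡n e≤n)

    open Rotation n e e≤n
    open Symmetry R using (to-injective)

    T₁ : Triangulation n (E on rotate n e)
    T₁ = triangulation-on R T

    degree₁ : DegreeAtMost 4 (E on rotate n e)
    degree₁ = degreeAtMost-on R T degree

    rotate-first : rotate n e 0 ≡ e
    rotate-first = rotate-unwrapped (<-trans (n<1+n e) e+1<n)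

    rotate-last : 0 < e → suc (rotate n e m) ≡ e
    rotate-last 0<e = +-cancelʳ-≡ m _ _ (begin
      suc (rotate n e m) + m  ≡⟨ +-suc (rotate n e m) m ⟨
      rotate n e m + n        ≡⟨ rotate-wrapped ≤-refl (subst (n ≤_) (+-comm e m) (+-monoˡ-≤ m 0<e)) ⟩
      m + e                   ≡⟨ +-comm m e ⟩
      e + m                   ∎)
      where open ≡-Reasoning

    ear₀ : ∀ {q} → E (rotate n e 0) (rotate n e q) ≡ true → q ≡ 1 ⊎ q ≡ m
    ear₀ {q} e₀q with proj₂ isEar (subst (λ p → E p (rotate n e q) ≡ true) rotate-first e₀q)
    ... | inj₁ rq+1≡e =
      inj₂ (to-injective q<n ≤-refl (suc-injective (trans rq+1≡e (sym (rotate-last (subst (0 <_) rq+1≡e z<s))))))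
      where
      q<n : q < n
      q<n = Triangulation.edge-<ʳ T₁ {0} e₀q
    ... | inj₂ rq≡e+1 = inj₁ (to-injective q<n (s≤s (s≤s z≤n)) (trans rq≡e+1 (sym (rotate-unwrapped {1} e+1<n))))
      where
      q<n : q < n
      q<n = Triangulation.edge-<ʳ T₁ {0} e₀q

    F : Symmetry n
    F = reflection n

    reflect-m : reflect n m ≡ 1
    reflect-m = trans (Reflection.reflect-inner n z<s ≤-refl) (m+n∸n≡m 1 l)

    reflectedEar : ∀ {q} → E (rotate n e 0) (rotate n e (reflect n q)) ≡ true → q ≡ 1 ⊎ q ≡ m
    reflectedEar {q} e₀q with ear₀ e₀q
    ... | inj₁ fq≡1 = inj₂ (Symmetry.to-injective F q<n ≤-refl (trans fq≡1 (sym reflect-m)))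
      where
      q<n : q < n
      q<n = Triangulation.edge-<ʳ (triangulation-on F T₁) {0} e₀q
    ... | inj₂ fq≡m = inj₁ (Symmetry.to-injective F q<n (s≤s (s≤s z≤n))
                             (trans fq≡m (sym (Reflection.reflect-inner n {1} z<s (s≤s (s≤s z≤n))))))
      where
      q<n : q < n
      q<n = Triangulation.edge-<ʳ (triangulation-on F T₁) {0} e₀q

    oriented : E (rotate n e 2) (rotate n e m) ≡ true ⊎ E (rotate n e 1) (rotate n e l) ≡ true → LinearLabelling n E
    oriented (inj₁ E2m) = labelled (Symmetry.bijection R) (T₁ , degree₁ , ear₀ , E2m)
    oriented (inj₂ E1l) = labelled (Symmetry.bijection R ∘ᵇ Symmetry.bijection F)
      ( triangulation-on F T₁ , degreeAtMost-on F T₁ degree₁ , reflectedEar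
      , subst₂ (λ a b → E (rotate n e a) (rotate n e b) ≡ true)
          (sym (Reflection.reflect-inner n {2} z<s (s≤s (s≤s (≤-trans (s≤s z≤n) 5≤l)))))
          (sym reflect-m)
          (Triangulation.flip T₁ {1} {l} E1l))

    normalForm : LinearLabelling n E
    normalForm = oriented (Zigzag.orientation T₁ degree₁ 5≤l ear₀)

  zigzagNormalForm : LinearLabelling n E
  zigzagNormalForm = Rotated.normalForm (proj₂ (ear T refl (s≤s (≤-trans (s≤s z≤n) 5≤l))))

addEdge-cases : ∀ {n} (A : Adj n) a b x y → addEdge A a b x y ≡ true →
  A x y ≡ true ⊎ (x ≡ a × y ≡ b) ⊎ (x ≡ b × y ≡ a)
addEdge-cases A a b x y added with A x y | x Fin.≟ a | y Fin.≟ b | x Fin.≟ b | y Fin.≟ a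
... | true | _ | _ | _ | _ = inj₁ refl
... | false | yes x≡a | yes y≡b | _ | _ = inj₂ (inj₁ (x≡a , y≡b))
... | false | yes _ | no _ | yes x≡b | yes y≡a = inj₂ (inj₂ (x≡b , y≡a))
... | false | no _ | _ | yes x≡b | yes y≡a = inj₂ (inj₂ (x≡b , y≡a))
addEdge-cases A a b x y () | false | yes _ | no _ | yes _ | no _
addEdge-cases A a b x y () | false | yes _ | no _ | no _ | _
addEdge-cases A a b x y () | false | no _ | _ | yes _ | no _
addEdge-cases A a b x y () | false | no _ | _ | no _ | _

module Positions {n : ℕ} (G : SimpleGraph n) (σ : Permutation′ n) where

  vertexAt : ∀ {p} → p < n → Fin n
  vertexAt p<n = σ ⟨$⟩ˡ fromℕ< p<n

  positionOf : Fin n → ℕ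
  positionOf v = toℕ (σ ⟨$⟩ʳ v)

  edgeAt : ℕ → ℕ → Bool
  edgeAt p q with p <? n | q <? n
  ... | yes p<n | yes q<n = adj G (vertexAt p<n) (vertexAt q<n)
  ... | _ | _ = false

  positionOf-< : ∀ v → positionOf v < n
  positionOf-< v = toℕ<n (σ ⟨$⟩ʳ v)

  positionOf-vertexAt : ∀ {p} (p<n : p < n) → positionOf (vertexAt p<n) ≡ p
  positionOf-vertexAt p<n = trans (cong toℕ (inverseʳ σ)) (toℕ-fromℕ< p<n)

  vertexAt-positionOf : ∀ v → vertexAt (positionOf-< v) ≡ v
  vertexAt-positionOf v = trans (cong (σ ⟨$⟩ˡ_) (fromℕ<-toℕ _ (positionOf-< v))) (inverseˡ σ)

  edgeAt-vertexAt : ∀ {p q} (p<n : p < n) (q<n : q < n) → edgeAt p q ≡ adj G (vertexAt p<n) (vertexAt q<n)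
  edgeAt-vertexAt {p} {q} p<n q<n with p <? n | q <? n
  ... | yes _ | yes _ = refl
  ... | no p≮n | _ = ⊥-elim (p≮n p<n)
  ... | yes _ | no q≮n = ⊥-elim (q≮n q<n)

  edgeAt-positionOf : ∀ u v → edgeAt (positionOf u) (positionOf v) ≡ adj G u v
  edgeAt-positionOf u v = trans (edgeAt-vertexAt (positionOf-< u) (positionOf-< v))
    (cong₂ (adj G) (vertexAt-positionOf u) (vertexAt-positionOf v))

  edgeAt-< : ∀ {p q} → edgeAt p q ≡ true → p < n
  edgeAt-< {p} {q} e with p <? n | q <? n
  ... | yes p<n | _ = p<n
  edgeAt-< () | no _ | yes _
  edgeAt-< () | no _ | no _

  edgeAt-symmetric : ∀ p q → edgeAt p q ≡ edgeAt q p
  edgeAt-symmetric p q with p <? n | q <? n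
  ... | yes _ | yes _ = symm G _ _
  ... | yes _ | no _ = refl
  ... | no _ | yes _ = refl
  ... | no _ | no _ = refl

  edgeAt-irreflexive : ∀ p → edgeAt p p ≡ false
  edgeAt-irreflexive p with p <? n
  ... | yes _ = irrefl G _
  ... | no _ = refl

  edgeAt-<ʳ : ∀ {p q} → edgeAt p q ≡ true → q < n
  edgeAt-<ʳ {p} {q} e = edgeAt-< (trans (edgeAt-symmetric q p) e)

  edgeAt-adj : ∀ {p q} (e : edgeAt p q ≡ true) → adj G (vertexAt (edgeAt-< e)) (vertexAt (edgeAt-<ʳ e)) ≡ true
  edgeAt-adj e = trans (sym (edgeAt-vertexAt (edgeAt-< e) (edgeAt-<ʳ e))) e

  triangulation : NoCrossing (adj G) σ →
    (∀ a b → a ≢ b → adj G a b ≡ false → ¬ Outerplanar (addEdge (adj G) a b)) → Triangulation n edgeAt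
  triangulation noCrossing saturated = record
    { edge-< = edgeAt-<
    ; symmetric = edgeAt-symmetric
    ; irreflexive = edgeAt-irreflexive
    ; noCrossing = ascending⇒noCrossing edgeAt-symmetric noAscendingCrossing
    ; maximal = maximal
    }
    where
    noAscendingCrossing : ∀ {a b c d} → edgeAt a c ≡ true → edgeAt b d ≡ true → ¬ Ascending a b c d
    noAscendingCrossing eac ebd (a<b , b<c , c<d) = noCrossing _ _ _ _ (edgeAt-adj eac) (edgeAt-adj ebd)
      (at (edgeAt-< eac) (edgeAt-< ebd) a<b) (at (edgeAt-< ebd) (edgeAt-<ʳ eac) b<c) (at (edgeAt-<ʳ eac) (edgeAt-<ʳ ebd) c<d)
      where
      at : ∀ {x y} (x<n : x < n) (y<n : y < n) → x < y → positionOf (vertexAt x<n) < positionOf (vertexAt y<n)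
      at x<n y<n = subst₂ _<_ (sym (positionOf-vertexAt x<n)) (sym (positionOf-vertexAt y<n))

    maximal : ∀ {p q} → p ≢ q → p < n → q < n →
      (∀ {a b} → edgeAt a b ≡ true → ¬ Crossing a p b q) → edgeAt p q ≡ true
    maximal {p} {q} p≢q p<n q<n uncrossed = trans (edgeAt-vertexAt p<n q<n) adjacent
      where
      u v : Fin n
      u = vertexAt p<n
      v = vertexAt q<n

      crosses : ∀ {x y} → adj G x y ≡ true → ¬ Crossing (positionOf x) (positionOf u) (positionOf y) (positionOf v)
      crosses {x} {y} e cr = uncrossed (trans (edgeAt-positionOf x y) e)
        (subst₂ (λ p′ q′ → Crossing (positionOf x) p′ (positionOf y) q′)
          (positionOf-vertexAt p<n) (positionOf-vertexAt q<n) cr)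

      stillNoCrossing : NoCrossing (addEdge (adj G) u v) σ
      stillNoCrossing u′ v′ x y e₁ e₂ l₁ l₂ l₃
        with addEdge-cases (adj G) u v u′ v′ e₁ | addEdge-cases (adj G) u v x y e₂
      ... | inj₁ old₁ | inj₁ old₂ = noCrossing u′ v′ x y old₁ old₂ l₁ l₂ l₃
      ... | inj₂ (inj₁ (refl , refl)) | inj₁ old = crosses old (crossing-swapʳ (crossing-rotate (inj₁ (inj₁ (l₁ , l₂ , l₃)))))
      ... | inj₂ (inj₂ (refl , refl)) | inj₁ old = crosses old (crossing-rotate (inj₁ (inj₁ (l₁ , l₂ , l₃))))
      ... | inj₁ old | inj₂ (inj₁ (refl , refl)) = crosses old (inj₁ (inj₁ (l₁ , l₂ , l₃)))
      ... | inj₁ old | inj₂ (inj₂ (refl , refl)) = crosses old (crossing-swapʳ (inj₁ (inj₁ (l₁ , l₂ , l₃))))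
      ... | inj₂ (inj₁ (refl , refl)) | inj₂ (inj₁ (refl , refl)) = <-irrefl refl l₁
      ... | inj₂ (inj₁ (refl , refl)) | inj₂ (inj₂ (refl , refl)) = <-irrefl refl l₂
      ... | inj₂ (inj₂ (refl , refl)) | inj₂ (inj₁ (refl , refl)) = <-irrefl refl l₂
      ... | inj₂ (inj₂ (refl , refl)) | inj₂ (inj₂ (refl , refl)) = <-irrefl refl l₁

      adjacent : adj G u v ≡ true
      adjacent with adj G u v in eq
      ... | true = refl
      ... | false = ⊥-elim (saturated u v (p≢q ∘ vertexAt-injective) eq (σ , stillNoCrossing))
        where
        vertexAt-injective : u ≡ v → p ≡ q
        vertexAt-injective u≡v = trans (sym (positionOf-vertexAt p<n)) (trans (cong positionOf u≡v) (positionOf-vertexAt q<n))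

  degreeAtMost : ∀ {k} → (∀ v → degree G v ≤ k) → DegreeAtMost k edgeAt
  degreeAtMost bound p {[]} _ _ = z≤n
  degreeAtMost bound p {_ ∷ _} ns! adjacent@(e ∷ _) =
    ≤-trans (length≤degree G positionOf ns! keyed) (bound (vertexAt (edgeAt-< e)))
    where
    keyed : ∀ {q} → q ∈ _ → ∃ λ u → adj G (vertexAt (edgeAt-< e)) u ≡ true × positionOf u ≡ q
    keyed q∈ns with All.lookup adjacent q∈ns
    ... | e′ = vertexAt (edgeAt-<ʳ e′) , edgeAt-adj e′ , positionOf-vertexAt (edgeAt-<ʳ e′)

  ≅linearTwoTree : LinearLabelling n edgeAt → G ≅ linearTwoTree n
  ≅linearTwoTree (B , labelled) = permutation labelOf vertexLabelled labelOf-vertexLabelled vertexLabelled-labelOf , preserves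
    where
    open Bijection B

    labelOf : Fin n → Fin n
    labelOf v = fromℕ< (from-< (positionOf-< v))

    vertexLabelled : Fin n → Fin n
    vertexLabelled L = vertexAt (to-< (toℕ<n L))

    vertexAt-cong : ∀ {p q} {p<n : p < n} {q<n : q < n} → p ≡ q → vertexAt p<n ≡ vertexAt q<n
    vertexAt-cong refl = refl

    labelOf-vertexLabelled : ∀ L → labelOf (vertexLabelled L) ≡ L
    labelOf-vertexLabelled L = toℕ-injective (trans (toℕ-fromℕ< _)
      (trans (cong from (positionOf-vertexAt (to-< (toℕ<n L)))) (from-to (toℕ<n L))))

    vertexLabelled-labelOf : ∀ v → vertexLabelled (labelOf v) ≡ v
    vertexLabelled-labelOf v = trans
      (vertexAt-cong {p<n = to-< (toℕ<n (labelOf v))} {q<n = positionOf-< v} (trans (cong to (toℕ-fromℕ< (from-< (positionOf-< v)))) (to-from (positionOf-< v))))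
      (vertexAt-positionOf v)

    preserves : ∀ u v → adj G u v ≡ linAdj n (labelOf u) (labelOf v)
    preserves u v = begin
      adj G u v                                    ≡⟨ edgeAt-positionOf u v ⟨
      edgeAt (positionOf u) (positionOf v)         ≡⟨ cong₂ edgeAt (to-from (positionOf-< u)) (to-from (positionOf-< v)) ⟨
      edgeAt (to (from (positionOf u))) (to (from (positionOf v)))
                                                   ≡⟨ labelled (from-< (positionOf-< u)) (from-< (positionOf-< v)) ⟩
      linAdjℕ (from (positionOf u)) (from (positionOf v))
                                                   ≡⟨ cong₂ linAdjℕ (toℕ-fromℕ< (from-< (positionOf-< u))) (toℕ-fromℕ< (from-< (positionOf-< v))) ⟨
      linAdj n (labelOf u) (labelOf v)             ∎
      where open ≡-Reasoning

maxDegree≡4⇒≅linearTwoTree : ∀ {n} (G : SimpleGraph n) → 7 ≤ n → MaximalOuterplanar G → maxDegree G ≡ 4 →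
  G ≅ linearTwoTree n
maxDegree≡4⇒≅linearTwoTree {suc (suc l)} G (s≤s (s≤s 5≤l)) ((σ , noCrossing) , saturated) Δ≡4 =
  ≅linearTwoTree (zigzagNormalForm (triangulation noCrossing saturated) (degreeAtMost Δ≤4) 5≤l)
  where
  open Positions G σ
  Δ≤4 : ∀ v → degree G v ≤ 4
  Δ≤4 v = ≤-trans (degree≤maxDegree G v) (≤-reflexive Δ≡4)

mainTheorem8 : (n : ℕ) → 7 ≤ n → (G : SimpleGraph n) → MaximalOuterplanar G →
    ((G ≅ linearTwoTree n → maxDegree G ≡ 4) × (maxDegree G ≡ 4 → G ≅ linearTwoTree n))
mainTheorem8 n 7≤n G maximalOuterplanar =
  ≅linearTwoTree⇒maxDegree≡4 G (≤-trans (m≤n⇒m≤1+n (n≤1+n 5)) 7≤n) , maxDegree≡4⇒≅linearTwoTree G 7≤n maximalOuterplanar
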